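{- Let $p$ be a prime with $p\mid F_{p-1}$, and for $n\ge1$ let $R_n$ be the $n\times n$ matrix with $(i,j)$ entry $\binom{i-1}{n-j}$. Then $R_n^{\,p-1}\equiv I_n\pmod p$ for every $n\ge 1$.
   Context: Convention: $\binom{m}{k}=0$ if $k<0$ or $k>m$. The Fibonacci sequence is $F_0=0$, $F_1=1$, $F_{m+1}=F_m+F_{m-1}$. Matrix congruences modulo $p$ are entrywise; $I_n$ is the identity matrix. -}

module Defs where

open import Data.Nat using (ℕ; zero; suc; _+_; _*_; _∸_; _%_; _≟_; NonZero)
open import Data.Nat.Combinatorics using (_C_)
open import Data.Fin using (Fin; toℕ)
import Data.Fin as F
open import Relation.Nullary using (yes; no)
open import Relation.Binary.PropositionalEquality using (_≡_)

fib : ℕ → ℕ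
fib zero = 0
fib (suc zero) = 1
fib (suc (suc m)) = fib (suc m) + fib m

Mat : ℕ → Set
Mat n = Fin n → Fin n → ℕ

∑ : (n : ℕ) → (Fin n → ℕ) → ℕ
∑ zero f = 0
∑ (suc n) f = f F.zero + ∑ n (λ i → f (F.suc i))

_⊗_ : {n : ℕ} → Mat n → Mat n → Mat n
_⊗_ {n} A B i j = ∑ n (λ k → A i k * B k j)

identity : (n : ℕ) → Mat n
identity n i j with toℕ i ≟ toℕ j
... | yes _ = 1
... | no _ = 0

_^ᴹ_ : {n : ℕ} → Mat n → ℕ → Mat n
_^ᴹ_ {n} A zero = identity n
_^ᴹ_ {n} A (suc k) = A ⊗ (A ^ᴹ k)

-- R_n : 1-based (i,j) entry C(i-1, n-j); with 0-based i', j' (i = i'+1, j = j'+1)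
-- this is C(i', n - (j'+1)). Note n - j ≥ 0 always, and C(a,b) = 0 for b > a.
R : (n : ℕ) → Mat n
R n i j = toℕ i C (n ∸ suc (toℕ j))

_≡ᴹ_[mod_] : {n : ℕ} → Mat n → Mat n → (p : ℕ) → .{{NonZero p}} → Set
A ≡ᴹ B [mod p ] = ∀ i j → A i j % p ≡ B i j % p

-- Row i of R_(d+1)^k is the coefficient vector of u_k^i v_k^(d-i), where
-- u_k = F_(k+1) x + F_k and v_k = F_k x + F_(k-1) (with F_(-1) = 1): multiplying
-- by R sums C(i,t) u_k^(d-t) v_k^t over t, which by the binomial theorem is
-- (u_k + v_k)^i u_k^(d-i) = u_(k+1)^i v_(k+1)^(d-i). For k = p - 1 the hypothesis
-- F_(p-1) ≡ 0 forces F_p ≡ 1 (mod p): the addition formula gives F_2p ≡ F_p^2 and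
-- F_(2p+1) ≡ 2 F_p^2, while sum_k C(p,k) F_(m+k) = F_(m+2p) and p ∣ C(p,k) for
-- 0 < k < p give F_2p ≡ F_p and F_(2p+1) ≡ 1 + F_p. Hence u_(p-1) ≡ x and
-- v_(p-1) ≡ 1, so row i of R^(p-1) is congruent to x^i.
module Submission where

open import Defs
open import Data.Empty using (⊥-elim)
open import Data.Fin using (Fin; toℕ)
import Data.Fin as Fin
open import Data.Fin.Properties using (toℕ<n)
open import Data.Nat
  using (ℕ; zero; suc; _+_; _*_; _∸_; _%_; _≤_; _<_; _≥_; z<s; s<s; _!; _≟_; NonZero)
open import Data.Nat.Properties
open import Data.Nat.Combinatorics using (_C_; nCn≡1; nCk+nC[k+1]≡[n+1]C[k+1]; k![n∸k]!∣n!)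
open import Data.Nat.Combinatorics.Specification using (nCk≡n!/k![n-k]!; k>n⇒nCk≡0)
open import Data.Nat.DivMod
open import Data.Nat.Divisibility
open import Data.Nat.Primality using (Prime; prime⇒nonZero; euclidsLemma; ¬prime[0]; ¬prime[1])
open import Data.Nat.Tactic.RingSolver using (solve-∀)
open import Data.Sum using (inj₁; inj₂)
open import Function.Base using (_∘_)
open import Function.Endo.Propositional (ℕ → ℕ) using (_^_)
open import Level using (0ℓ)
open import Relation.Binary.Bundles using (Setoid)
open import Relation.Binary.PropositionalEquality
open import Relation.Nullary using (¬_; yes; no)
import Relation.Binary.Reasoning.Setoid as SetoidReasoning

∑ℕ : ℕ → (ℕ → ℕ) → ℕ
∑ℕ n f = ∑ n (f ∘ toℕ)

∑-cong : ∀ n {f g : Fin n → ℕ} → (∀ i → f i ≡ g i) → ∑ n f ≡ ∑ n g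
∑-cong zero    f≡g = refl
∑-cong (suc n) f≡g = cong₂ _+_ (f≡g Fin.zero) (∑-cong n (f≡g ∘ Fin.suc))

∑ℕ-cong : ∀ n {f g : ℕ → ℕ} → (∀ k → k < n → f k ≡ g k) → ∑ℕ n f ≡ ∑ℕ n g
∑ℕ-cong n f≡g = ∑-cong n (λ i → f≡g (toℕ i) (toℕ<n i))

∑ℕ-zero : ∀ n → ∑ℕ n (λ _ → 0) ≡ 0
∑ℕ-zero zero    = refl
∑ℕ-zero (suc n) = ∑ℕ-zero n

∑ℕ-distrib-+ : ∀ n (f g : ℕ → ℕ) → ∑ℕ n (λ k → f k + g k) ≡ ∑ℕ n f + ∑ℕ n g
∑ℕ-distrib-+ zero    f g = refl
∑ℕ-distrib-+ (suc n) f g = begin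
  f 0 + g 0 + ∑ℕ n (λ k → f (suc k) + g (suc k))        ≡⟨ cong (f 0 + g 0 +_) (∑ℕ-distrib-+ n (f ∘ suc) (g ∘ suc)) ⟩
  f 0 + g 0 + (∑ℕ n (f ∘ suc) + ∑ℕ n (g ∘ suc))         ≡⟨ +-interchange (f 0) _ _ _ ⟩
  f 0 + ∑ℕ n (f ∘ suc) + (g 0 + ∑ℕ n (g ∘ suc))         ∎
  where
  open ≡-Reasoning
  +-interchange : ∀ a b c d → a + b + (c + d) ≡ a + c + (b + d)
  +-interchange = solve-∀

∑ℕ-snoc : ∀ n (f : ℕ → ℕ) → ∑ℕ (suc n) f ≡ ∑ℕ n f + f n
∑ℕ-snoc zero    f = +-comm (f 0) 0
∑ℕ-snoc (suc n) f = trans (cong (f 0 +_) (∑ℕ-snoc n (f ∘ suc))) (sym (+-assoc (f 0) _ _))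

∑ℕ-reverse : ∀ n (f : ℕ → ℕ → ℕ) → ∑ℕ (suc n) (λ m → f m (n ∸ m)) ≡ ∑ℕ (suc n) (λ t → f (n ∸ t) t)
∑ℕ-reverse zero    f = refl
∑ℕ-reverse (suc n) f = begin
  f 0 (suc n) + ∑ℕ (suc n) (λ m → f (suc m) (n ∸ m))       ≡⟨ cong (f 0 (suc n) +_) (∑ℕ-reverse n (f ∘ suc)) ⟩
  f 0 (suc n) + ∑ℕ (suc n) (λ t → f (suc (n ∸ t)) t)       ≡⟨ cong (f 0 (suc n) +_) (∑ℕ-cong (suc n) suc-∸) ⟨
  f 0 (suc n) + ∑ℕ (suc n) (λ t → f (suc n ∸ t) t)         ≡⟨ +-comm (f 0 (suc n)) _ ⟩
  ∑ℕ (suc n) (λ t → f (suc n ∸ t) t) + f 0 (suc n)         ≡⟨ cong (λ m → ∑ℕ (suc n) (λ t → f (suc n ∸ t) t) + f m (suc n)) (n∸n≡0 n) ⟨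
  ∑ℕ (suc n) (λ t → f (suc n ∸ t) t) + f (n ∸ n) (suc n)   ≡⟨ ∑ℕ-snoc (suc n) (λ t → f (suc n ∸ t) t) ⟨
  ∑ℕ (suc (suc n)) (λ t → f (suc n ∸ t) t)                 ∎
  where
  open ≡-Reasoning
  suc-∸ : ∀ t → t < suc n → f (suc n ∸ t) t ≡ f (suc (n ∸ t)) t
  suc-∸ t t<1+n = cong (λ m → f m t) (+-∸-assoc 1 (≤-pred t<1+n))

∑ℕ-pascal : ∀ n N (h : ℕ → ℕ) →
  ∑ℕ (suc N) (λ k → (suc n C k) * h k) ≡ ∑ℕ N (λ k → (n C k) * h (suc k)) + ∑ℕ (suc N) (λ k → (n C k) * h k)
∑ℕ-pascal n N h = begin
  1 * h 0 + ∑ℕ N (λ k → (suc n C suc k) * h (suc k))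
    ≡⟨ cong (1 * h 0 +_) (∑ℕ-cong N (λ k _ → pascal k)) ⟩
  1 * h 0 + ∑ℕ N (λ k → lower k + upper k)
    ≡⟨ cong (1 * h 0 +_) (∑ℕ-distrib-+ N lower upper) ⟩
  1 * h 0 + (∑ℕ N lower + ∑ℕ N upper)
    ≡⟨ x+[y+z]≡y+[x+z] (1 * h 0) (∑ℕ N lower) (∑ℕ N upper) ⟩
  ∑ℕ N lower + (1 * h 0 + ∑ℕ N upper)
    ∎
  where
  open ≡-Reasoning
  lower upper : ℕ → ℕ
  lower k = (n C k) * h (suc k)
  upper k = (n C suc k) * h (suc k)
  pascal : ∀ k → (suc n C suc k) * h (suc k) ≡ (n C k) * h (suc k) + (n C suc k) * h (suc k)
  pascal k = trans (cong (_* h (suc k)) (sym (nCk+nC[k+1]≡[n+1]C[k+1] n k))) (*-distribʳ-+ (h (suc k)) (n C k) _)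
  x+[y+z]≡y+[x+z] : ∀ x y z → x + (y + z) ≡ y + (x + z)
  x+[y+z]≡y+[x+z] = solve-∀

module Modulo (p : ℕ) .{{_ : NonZero p}} where

  -- A record rather than a synonym, so that unification never has to invert _%_.
  infix 4 _≈_
  record _≈_ (a b : ℕ) : Set where
    constructor mk≈
    field %-≡ : a % p ≡ b % p

  ≈-setoid : Setoid 0ℓ 0ℓ
  ≈-setoid = record
    { _≈_           = _≈_
    ; isEquivalence = record
      { refl  = mk≈ refl
      ; sym   = λ (mk≈ e) → mk≈ (sym e)
      ; trans = λ (mk≈ e) (mk≈ e′) → mk≈ (trans e e′)
      }
    }

  open Setoid ≈-setoid public using () renaming (refl to ≈-refl; trans to ≈-trans)
  module ≈-Reasoning = SetoidReasoning ≈-setoid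

  +-cong-≈ : ∀ {a a′ b b′} → a ≈ a′ → b ≈ b′ → a + b ≈ a′ + b′
  +-cong-≈ {a} {a′} {b} {b′} (mk≈ a≡a′) (mk≈ b≡b′) = mk≈
    (trans (%-distribˡ-+ a b p) (trans (cong₂ (λ x y → (x + y) % p) a≡a′ b≡b′) (sym (%-distribˡ-+ a′ b′ p))))

  +-congˡ-≈ : ∀ a {b b′} → b ≈ b′ → a + b ≈ a + b′
  +-congˡ-≈ a = +-cong-≈ (≈-refl {a})

  +-congʳ-≈ : ∀ {a a′} b → a ≈ a′ → a + b ≈ a′ + b
  +-congʳ-≈ b a≈a′ = +-cong-≈ a≈a′ (≈-refl {b})

  *-cong-≈ : ∀ {a a′ b b′} → a ≈ a′ → b ≈ b′ → a * b ≈ a′ * b′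
  *-cong-≈ {a} {a′} {b} {b′} (mk≈ a≡a′) (mk≈ b≡b′) = mk≈
    (trans (%-distribˡ-* a b p) (trans (cong₂ (λ x y → (x * y) % p) a≡a′ b≡b′) (sym (%-distribˡ-* a′ b′ p))))

  ∣⇒≈0 : ∀ {a} → p ∣ a → a ≈ 0
  ∣⇒≈0 {a} p∣a = mk≈ (trans (n∣m⇒m%n≡0 a p p∣a) (sym (n∣m⇒m%n≡0 0 p (p ∣0))))

  +-cancelʳ-≈ : ∀ {a b} c → a + c ≈ b + c → a ≈ b
  +-cancelʳ-≈ {a} {b} c a+c≈b+c = begin
    a           ≈⟨ absorb a ⟨
    a + c + c̄   ≈⟨ +-congʳ-≈ c̄ a+c≈b+c ⟩
    b + c + c̄   ≈⟨ absorb b ⟩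
    b           ∎
    where
    open ≈-Reasoning
    c̄ = p ∸ c % p
    absorb : ∀ x → x + c + c̄ ≈ x
    absorb x = begin
      x + c + c̄         ≡⟨ +-assoc x c c̄ ⟩
      x + (c + c̄)       ≈⟨ +-congˡ-≈ x (+-congʳ-≈ c̄ (mk≈ (m%n%n≡m%n c p))) ⟨
      x + (c % p + c̄)   ≡⟨ cong (x +_) (m+[n∸m]≡n (m%n≤n c p)) ⟩
      x + p             ≈⟨ mk≈ ([m+n]%n≡m%n x p) ⟩
      x                 ∎

  ∑ℕ-cong-≈ : ∀ n {f g : ℕ → ℕ} → (∀ k → k < n → f k ≈ g k) → ∑ℕ n f ≈ ∑ℕ n g
  ∑ℕ-cong-≈ zero    f≈g = ≈-refl
  ∑ℕ-cong-≈ (suc n) f≈g = +-cong-≈ (f≈g 0 z<s) (∑ℕ-cong-≈ n (λ k k<n → f≈g (suc k) (s<s k<n)))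

¬prime∣m! : ∀ {p} → Prime p → ∀ m → m < p → ¬ p ∣ m !
¬prime∣m! pr zero    _   p∣1   = ¬prime[1] (subst Prime (∣1⇒≡1 p∣1) pr)
¬prime∣m! pr (suc m) m<p p∣m!′ with euclidsLemma (suc m) (m !) pr p∣m!′
... | inj₁ p∣1+m = <⇒≱ m<p (∣⇒≤ p∣1+m)
... | inj₂ p∣m!  = ¬prime∣m! pr m (<-trans (n<1+n m) m<p) p∣m!

nCk*k![n∸k]!≡n! : ∀ {n k} → k ≤ n → (n C k) * (k ! * (n ∸ k) !) ≡ n !
nCk*k![n∸k]!≡n! {n} {k} k≤n =
  trans (cong (_* (k ! * (n ∸ k) !)) (nCk≡n!/k![n-k]! k≤n)) (m/n*n≡m (k![n∸k]!∣n! k≤n))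
  where instance _ = k !* (n ∸ k) !≢0

-- p divides p! = C(p,k) k! (p-k)! but neither k! nor (p-k)!.
prime∣pCk : ∀ {p k} → Prime p → 0 < k → k < p → p ∣ p C k
prime∣pCk {suc q} {k} pr 0<k k<p
  with euclidsLemma (suc q C k) (k ! * (suc q ∸ k) !) pr
         (subst (suc q ∣_) (sym (nCk*k![n∸k]!≡n! (<⇒≤ k<p))) (m∣m*n (q !)))
... | inj₁ p∣pCk = p∣pCk
... | inj₂ p∣k![p∸k]! with euclidsLemma (k !) ((suc q ∸ k) !) pr p∣k![p∸k]!
...   | inj₁ p∣k!    = ⊥-elim (¬prime∣m! pr k k<p p∣k!)
...   | inj₂ p∣[p∸k]! = ⊥-elim (¬prime∣m! pr (suc q ∸ k) (∸-monoʳ-< {suc q} {k} {0} 0<k (<⇒≤ k<p)) p∣[p∸k]!)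

fib-+ : ∀ m n → fib (suc (m + n)) ≡ fib (suc m) * fib (suc n) + fib m * fib n
fib-+ zero    n = sym (trans (cong (_+ 0) (*-identityˡ (fib (suc n)))) (+-identityʳ (fib (suc n))))
fib-+ (suc m) n = begin
  fib (suc (suc m + n))                                       ≡⟨ cong (fib ∘ suc) (+-suc m n) ⟨
  fib (suc (m + suc n))                                       ≡⟨ fib-+ m (suc n) ⟩
  fib (suc m) * (fib (suc n) + fib n) + fib m * fib (suc n)   ≡⟨ regroup (fib (suc m)) (fib m) (fib (suc n)) (fib n) ⟩
  (fib (suc m) + fib m) * fib (suc n) + fib (suc m) * fib n   ∎
  where
  open ≡-Reasoning
  regroup : ∀ a b c d → a * (c + d) + b * c ≡ (a + b) * c + a * d
  regroup = solve-∀

fib-binomial : ∀ n m → ∑ℕ (suc n) (λ k → (n C k) * fib (m + k)) ≡ fib (m + (n + n))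
fib-binomial zero    m = trans (+-identityʳ (1 * fib (m + 0))) (*-identityˡ (fib (m + 0)))
fib-binomial (suc n) m = begin
  ∑ℕ (suc (suc n)) (λ k → (suc n C k) * fib (m + k))                    ≡⟨ ∑ℕ-pascal n (suc n) (λ k → fib (m + k)) ⟩
  ∑ℕ (suc n) (λ k → (n C k) * fib (m + suc k)) + ∑ℕ (suc (suc n)) term   ≡⟨ cong₂ _+_ shifted unshifted ⟩
  fib (suc m + (n + n)) + fib (m + (n + n))                             ≡⟨ cong fib (index m n) ⟩
  fib (m + (suc n + suc n))                                             ∎
  where
  open ≡-Reasoning
  term : ℕ → ℕ
  term k = (n C k) * fib (m + k)
  shifted : ∑ℕ (suc n) (λ k → (n C k) * fib (m + suc k)) ≡ fib (suc m + (n + n))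
  shifted = trans (∑ℕ-cong (suc n) (λ k _ → cong (λ i → (n C k) * fib i) (+-suc m k))) (fib-binomial n (suc m))
  unshifted : ∑ℕ (suc (suc n)) term ≡ fib (m + (n + n))
  unshifted = begin
    ∑ℕ (suc (suc n)) term                          ≡⟨ ∑ℕ-snoc (suc n) term ⟩
    ∑ℕ (suc n) term + (n C suc n) * fib (m + suc n) ≡⟨ cong (λ c → ∑ℕ (suc n) term + c * fib (m + suc n)) (k>n⇒nCk≡0 (n<1+n n)) ⟩
    ∑ℕ (suc n) term + 0                            ≡⟨ +-identityʳ _ ⟩
    ∑ℕ (suc n) term                                ≡⟨ fib-binomial n m ⟩
    fib (m + (n + n))                              ∎
  index : ∀ m n → suc (suc (m + (n + n))) ≡ m + (suc n + suc n)
  index = solve-∀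

module _ {q} (pr : Prime (suc q)) where
  open Modulo (suc q)
  open ≈-Reasoning

  ∑-binomial-prime-≈ : ∀ (x : ℕ → ℕ) → ∑ℕ (suc (suc q)) (λ k → (suc q C k) * x k) ≈ x 0 + x (suc q)
  ∑-binomial-prime-≈ x = begin
    1 * x 0 + ∑ℕ (suc q) (λ k → (suc q C suc k) * x (suc k))
      ≡⟨ cong (1 * x 0 +_) (∑ℕ-snoc q middle) ⟩
    1 * x 0 + (∑ℕ q middle + (suc q C suc q) * x (suc q))
      ≈⟨ +-congˡ-≈ (1 * x 0) (+-congʳ-≈ ((suc q C suc q) * x (suc q)) (∑ℕ-cong-≈ q middle≈0)) ⟩
    1 * x 0 + (∑ℕ q (λ _ → 0) + (suc q C suc q) * x (suc q))
      ≡⟨ cong₂ (λ a b → a + (b + (suc q C suc q) * x (suc q))) (*-identityˡ (x 0)) (∑ℕ-zero q) ⟩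
    x 0 + (suc q C suc q) * x (suc q)
      ≡⟨ cong (λ c → x 0 + c * x (suc q)) (nCn≡1 (suc q)) ⟩
    x 0 + 1 * x (suc q)
      ≡⟨ cong (x 0 +_) (*-identityˡ (x (suc q))) ⟩
    x 0 + x (suc q) ∎
    where
    middle : ℕ → ℕ
    middle k = (suc q C suc k) * x (suc k)
    middle≈0 : ∀ k → k < q → middle k ≈ 0
    middle≈0 k k<q = ∣⇒≈0 (∣m⇒∣m*n (x (suc k)) (prime∣pCk pr z<s (s<s k<q)))

  fib-prime≈1 : suc q ∣ fib q → fib (suc q) ≈ 1
  fib-prime≈1 p∣F[p-1] = +-cancelʳ-≈ ε (begin
    ε + ε                    ≈⟨ +-cong-≈ ε²≈ε ε²≈ε ⟨
    ε * ε + ε * ε            ≈⟨ +-congʳ-≈ (ε * ε) (*-cong-≈ F[p+1]≈ε F[p+1]≈ε) ⟨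
    F[p+1] * F[p+1] + ε * ε  ≡⟨ fib-+ p p ⟨
    fib (1 + (p + p))        ≡⟨ fib-binomial p 1 ⟨
    ∑ℕ (suc p) (λ k → (p C k) * fib (1 + k))
                             ≈⟨ ∑-binomial-prime-≈ (λ k → fib (1 + k)) ⟩
    1 + F[p+1]               ≈⟨ +-congˡ-≈ 1 F[p+1]≈ε ⟩
    1 + ε                    ∎)
    where
    p = suc q
    ε = fib p
    F[p+1] = fib (suc p)
    F[p-1]≈0 : fib q ≈ 0
    F[p-1]≈0 = ∣⇒≈0 p∣F[p-1]
    F[p+1]≈ε : F[p+1] ≈ ε
    F[p+1]≈ε = mk≈ (%-remove-+ʳ ε p∣F[p-1])
    ε²≈ε : ε * ε ≈ ε
    ε²≈ε = begin
      ε * ε                       ≈⟨ *-cong-≈ (≈-refl {ε}) F[p+1]≈ε ⟨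
      ε * F[p+1]                  ≡⟨ +-identityʳ (ε * F[p+1]) ⟨
      ε * F[p+1] + 0              ≈⟨ +-congˡ-≈ (ε * F[p+1]) (*-cong-≈ F[p-1]≈0 (≈-refl {ε})) ⟨
      ε * F[p+1] + fib q * ε      ≡⟨ fib-+ q p ⟨
      fib (p + p)                 ≡⟨ fib-binomial p 0 ⟨
      ∑ℕ (suc p) (λ k → (p C k) * fib k)
                                  ≈⟨ ∑-binomial-prime-≈ fib ⟩
      ε                           ∎

-- Polynomials are represented by their coefficient sequences; (a x+ b) multiplies by a x + b.
Poly : Set
Poly = ℕ → ℕ

infixl 6 _⊕_
_⊕_ : Poly → Poly → Poly
(f ⊕ g) k = f k + g k

one : Poly
one zero    = 1
one (suc _) = 0

shift : Poly → Poly
shift f zero    = 0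
shift f (suc k) = f k

infix 8 _x+_
_x+_ : ℕ → ℕ → Poly → Poly
(a x+ b) f k = a * shift f k + b * f k

x+-cong : ∀ a b {f g} → f ≗ g → (a x+ b) f ≗ (a x+ b) g
x+-cong a b f≗g zero    = cong (λ y → a * 0 + b * y) (f≗g 0)
x+-cong a b f≗g (suc k) = cong₂ (λ x y → a * x + b * y) (f≗g k) (f≗g (suc k))

^-cong : ∀ m a b {f g} → f ≗ g → ((a x+ b) ^ m) f ≗ ((a x+ b) ^ m) g
^-cong zero    a b f≗g = f≗g
^-cong (suc m) a b f≗g = x+-cong a b (^-cong m a b f≗g)

shift-⊕ : ∀ f g → shift (f ⊕ g) ≗ shift f ⊕ shift g
shift-⊕ f g zero    = refl
shift-⊕ f g (suc k) = refl

shift-x+ : ∀ a b f → shift ((a x+ b) f) ≗ (a x+ b) (shift f)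
shift-x+ a b f zero    = sym (cong₂ _+_ (*-zeroʳ a) (*-zeroʳ b))
shift-x+ a b f (suc k) = refl

x+-distrib-⊕ : ∀ a b f g → (a x+ b) (f ⊕ g) ≗ (a x+ b) f ⊕ (a x+ b) g
x+-distrib-⊕ a b f g k =
  trans (cong (λ s → a * s + b * (f k + g k)) (shift-⊕ f g k)) (distrib a b (shift f k) (shift g k) (f k) (g k))
  where
  distrib : ∀ a b x y u v → a * (x + y) + b * (u + v) ≡ a * x + b * u + (a * y + b * v)
  distrib = solve-∀

^-distrib-⊕ : ∀ m a b f g → ((a x+ b) ^ m) (f ⊕ g) ≗ ((a x+ b) ^ m) f ⊕ ((a x+ b) ^ m) g
^-distrib-⊕ zero    a b f g k = refl
^-distrib-⊕ (suc m) a b f g k = trans (x+-cong a b (^-distrib-⊕ m a b f g) k) (x+-distrib-⊕ a b _ _ k)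

x+-comm : ∀ a b c d f → (a x+ b) ((c x+ d) f) ≗ (c x+ d) ((a x+ b) f)
x+-comm a b c d f k = begin
  a * shift ((c x+ d) f) k + b * (c * shift f k + d * f k)
    ≡⟨ cong (λ s → a * s + b * (c * shift f k + d * f k)) (shift-x+ c d f k) ⟩
  a * (c * shift (shift f) k + d * shift f k) + b * (c * shift f k + d * f k)
    ≡⟨ comm a b c d (shift (shift f) k) (shift f k) (f k) ⟩
  c * (a * shift (shift f) k + b * shift f k) + d * (a * shift f k + b * f k)
    ≡⟨ cong (λ s → c * s + d * (a * shift f k + b * f k)) (shift-x+ a b f k) ⟨
  c * shift ((a x+ b) f) k + d * (a * shift f k + b * f k)
    ∎
  where
  open ≡-Reasoning
  comm : ∀ a b c d x y z → a * (c * x + d * y) + b * (c * y + d * z) ≡ c * (a * x + b * y) + d * (a * y + b * z)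
  comm = solve-∀

^-comm : ∀ m a b c d f → (a x+ b) (((c x+ d) ^ m) f) ≗ ((c x+ d) ^ m) ((a x+ b) f)
^-comm zero    a b c d f k = refl
^-comm (suc m) a b c d f k = trans (x+-comm a b c d _ k) (x+-cong c d (^-comm m a b c d f) k)

x+-+ : ∀ a b c d f → (a x+ b) f ⊕ (c x+ d) f ≗ ((a + c) x+ (b + d)) f
x+-+ a b c d f k = distrib a b c d (shift f k) (f k)
  where
  distrib : ∀ a b c d x y → a * x + b * y + (c * x + d * y) ≡ (a + c) * x + (b + d) * y
  distrib = solve-∀

module Binomial (a b c d : ℕ) where

  A B : Poly → Poly
  A = a x+ b
  B = c x+ d

  binomial-sum : ℕ → ℕ → Poly → Poly
  binomial-sum D i g k = ∑ℕ (suc D) (λ t → (i C t) * (A ^ (D ∸ t)) ((B ^ t) g) k)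

  binomial-sum-pascal : ∀ D i g → binomial-sum (suc D) (suc i) g ≗ binomial-sum D i (B g) ⊕ binomial-sum (suc D) i g
  binomial-sum-pascal D i g k = trans (∑ℕ-pascal i (suc D) (λ t → (A ^ (suc D ∸ t)) ((B ^ t) g) k))
    (cong (_+ binomial-sum (suc D) i g k) (∑ℕ-cong (suc D) (λ t _ →
      cong ((i C t) *_) (^-cong (D ∸ t) a b (^-comm t c d c d g) k))))

  binomial : ∀ i e g → binomial-sum (i + e) i g ≗ (((a + c) x+ (b + d)) ^ i) ((A ^ e) g)
  binomial zero    e g k = trans (cong (1 * (A ^ e) g k +_) (∑ℕ-zero e)) (trans (+-identityʳ _) (*-identityˡ _))
  binomial (suc i) e g k = begin
    binomial-sum (suc (i + e)) (suc i) g k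
      ≡⟨ binomial-sum-pascal (i + e) i g k ⟩
    binomial-sum (i + e) i (B g) k + binomial-sum (suc (i + e)) i g k
      ≡⟨ cong (λ D → binomial-sum (i + e) i (B g) k + binomial-sum D i g k) (+-suc i e) ⟨
    binomial-sum (i + e) i (B g) k + binomial-sum (i + suc e) i g k
      ≡⟨ cong₂ _+_ (binomial i e (B g) k) (binomial i (suc e) g k) ⟩
    (C ^ i) ((A ^ e) (B g)) k + (C ^ i) (A ((A ^ e) g)) k
      ≡⟨ ^-distrib-⊕ i (a + c) (b + d) ((A ^ e) (B g)) (A ((A ^ e) g)) k ⟨
    (C ^ i) ((A ^ e) (B g) ⊕ A ((A ^ e) g)) k
      ≡⟨ ^-cong i (a + c) (b + d) reorder k ⟨
    (C ^ i) (A ((A ^ e) g) ⊕ B ((A ^ e) g)) k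
      ≡⟨ ^-cong i (a + c) (b + d) (x+-+ a b c d ((A ^ e) g)) k ⟩
    (C ^ i) (C ((A ^ e) g)) k
      ≡⟨ ^-comm i (a + c) (b + d) (a + c) (b + d) ((A ^ e) g) k ⟨
    (C ^ suc i) ((A ^ e) g) k ∎
    where
    open ≡-Reasoning
    C = (a + c) x+ (b + d)
    reorder : A ((A ^ e) g) ⊕ B ((A ^ e) g) ≗ (A ^ e) (B g) ⊕ A ((A ^ e) g)
    reorder j = trans (+-comm (A ((A ^ e) g) j) _) (cong (_+ A ((A ^ e) g) j) (^-comm e c d a b g j))

module _ {p} .{{_ : NonZero p}} where
  open Modulo p

  ^-cong-≈ : ∀ m {a a′ b b′ f f′} → a ≈ a′ → b ≈ b′ → (∀ k → f k ≈ f′ k) →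
             ∀ k → ((a x+ b) ^ m) f k ≈ ((a′ x+ b′) ^ m) f′ k
  ^-cong-≈ zero    a≈a′ b≈b′ f≈f′ = f≈f′
  ^-cong-≈ (suc m) a≈a′ b≈b′ f≈f′ k =
    +-cong-≈ (*-cong-≈ a≈a′ (shift-≈ (^-cong-≈ m a≈a′ b≈b′ f≈f′) k)) (*-cong-≈ b≈b′ (^-cong-≈ m a≈a′ b≈b′ f≈f′ k))
    where
    shift-≈ : ∀ {g g′} → (∀ k → g k ≈ g′ k) → ∀ k → shift g k ≈ shift g′ k
    shift-≈ g≈g′ zero    = ≈-refl
    shift-≈ g≈g′ (suc k) = g≈g′ k

0x+1^m≗id : ∀ m f → ((0 x+ 1) ^ m) f ≗ f
0x+1^m≗id zero    f k = refl
0x+1^m≗id (suc m) f k = trans (+-identityʳ _) (0x+1^m≗id m f k)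

1x+0^i-one-diag : ∀ i → ((1 x+ 0) ^ i) one i ≡ 1
1x+0^i-one-diag zero    = refl
1x+0^i-one-diag (suc i) = trans (+-identityʳ _) (trans (+-identityʳ _) (1x+0^i-one-diag i))

1x+0^i-one-off : ∀ i j → i ≢ j → ((1 x+ 0) ^ i) one j ≡ 0
1x+0^i-one-off zero    zero    i≢j = ⊥-elim (i≢j refl)
1x+0^i-one-off zero    (suc j) i≢j = refl
1x+0^i-one-off (suc i) zero    i≢j = refl
1x+0^i-one-off (suc i) (suc j) i≢j =
  trans (+-identityʳ _) (trans (+-identityʳ _) (1x+0^i-one-off i j (i≢j ∘ cong suc)))

fib⁻ : ℕ → ℕ
fib⁻ zero    = 1
fib⁻ (suc k) = fib k

fib+fib⁻ : ∀ k → fib k + fib⁻ k ≡ fib (suc k)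
fib+fib⁻ zero    = refl
fib+fib⁻ (suc k) = refl

row : ℕ → ℕ → ℕ → Poly
row d k i = ((fib (suc k) x+ fib k) ^ i) (((fib k x+ fib⁻ k) ^ (d ∸ i)) one)

row-zero : ∀ d i → row d 0 i ≗ ((1 x+ 0) ^ i) one
row-zero d i = ^-cong i 1 0 (0x+1^m≗id (d ∸ i) one)

R^k≡row : ∀ d k (i j : Fin (suc d)) → (R (suc d) ^ᴹ k) i j ≡ row d k (toℕ i) (toℕ j)
R^k≡row d zero i j with toℕ i ≟ toℕ j
... | yes i≡j = sym (trans (row-zero d (toℕ i) (toℕ j))
                           (subst (λ j → ((1 x+ 0) ^ toℕ i) one j ≡ 1) i≡j (1x+0^i-one-diag (toℕ i))))
... | no i≢j  = sym (trans (row-zero d (toℕ i) (toℕ j)) (1x+0^i-one-off (toℕ i) (toℕ j) i≢j))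
R^k≡row d (suc k) i j = begin
  ∑ (suc d) (λ m → (toℕ i C (d ∸ toℕ m)) * (R (suc d) ^ᴹ k) m j)
    ≡⟨ ∑-cong (suc d) (λ m → cong ((toℕ i C (d ∸ toℕ m)) *_) (R^k≡row d k m j)) ⟩
  ∑ℕ (suc d) (λ m → (toℕ i C (d ∸ m)) * row d k m (toℕ j))
    ≡⟨ ∑ℕ-reverse d (λ m t → (toℕ i C t) * ((u ^ m) ((v ^ t) one)) (toℕ j)) ⟩
  binomial-sum d (toℕ i) one (toℕ j)
    ≡⟨ cong (λ D → binomial-sum D (toℕ i) one (toℕ j)) (m+[n∸m]≡n (≤-pred (toℕ<n i))) ⟨
  binomial-sum (toℕ i + (d ∸ toℕ i)) (toℕ i) one (toℕ j)
    ≡⟨ binomial (toℕ i) (d ∸ toℕ i) one (toℕ j) ⟩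
  ((fib (suc (suc k)) x+ (fib k + fib⁻ k)) ^ toℕ i) ((u ^ (d ∸ toℕ i)) one) (toℕ j)
    ≡⟨ cong (λ c → ((fib (suc (suc k)) x+ c) ^ toℕ i) ((u ^ (d ∸ toℕ i)) one) (toℕ j)) (fib+fib⁻ k) ⟩
  row d (suc k) (toℕ i) (toℕ j) ∎
  where
  open ≡-Reasoning
  open Binomial (fib (suc k)) (fib k) (fib k) (fib⁻ k) renaming (A to u; B to v)

theorem11 : (p : ℕ) (pr : Prime p) → p ∣ fib (p ∸ 1) →
    (n : ℕ) → n ≥ 1 →
    _≡ᴹ_[mod_] (R n ^ᴹ (p ∸ 1)) (identity n) p {{prime⇒nonZero pr}}
theorem11 0 pr _ _ _ = ⊥-elim (¬prime[0] pr)
theorem11 1 pr _ _ _ = ⊥-elim (¬prime[1] pr)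
theorem11 p@(suc q@(suc r)) pr p∣F[p-1] (suc d) _ i j = _≈_.%-≡ (begin
  (R (suc d) ^ᴹ q) i j            ≡⟨ R^k≡row d q i j ⟩
  row d q (toℕ i) (toℕ j)         ≈⟨ ^-cong-≈ (toℕ i) F[p]≈1 F[p-1]≈0 (^-cong-≈ (d ∸ toℕ i) F[p-1]≈0 F[p-2]≈1 (λ _ → ≈-refl)) (toℕ j) ⟩
  row d 0 (toℕ i) (toℕ j)         ≡⟨ R^k≡row d 0 i j ⟨
  identity (suc d) i j            ∎)
  where
  open Modulo p
  open ≈-Reasoning
  F[p]≈1 : fib p ≈ 1
  F[p]≈1 = fib-prime≈1 pr p∣F[p-1]
  F[p-1]≈0 : fib q ≈ 0
  F[p-1]≈0 = ∣⇒≈0 p∣F[p-1]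
  F[p-2]≈1 : fib r ≈ 1
  F[p-2]≈1 = ≈-trans (mk≈ (sym (%-remove-+ˡ (fib r) p∣F[p-1]))) F[p]≈1
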